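{- Let $T$ be a finite tree, $\omega$ a nonnegative integer function on $V(T)$, and $D$ a distribution on $T$ which is not $\omega$-solvable. Let $x,y$ be adjacent vertices. If $C_x(y)\ge 0$, then $C_y(x)<0$.
   Context: A distribution assigns nonnegative integers (pebbles) to vertices. A pebbling move removes two pebbles from a vertex and adds one to an adjacent vertex; $D$ is $\omega$-solvable if pebbling moves reach $D^*\ge\omega$ pointwise. Let $C=D-\omega$. For a leaf $v$ of a tree with neighbor $u$, the induced function on the tree minus $v$ is $C'$ with $C'(z)=C(z)$ for $z\ne u$, $C'(u)=C(u)+\lfloor C(v)/2\rfloor$ if $C(v)\ge0$ and $C'(u)=C(u)+2C(v)$ if $C(v)<0$. For a subtree $T^*$, the induced generalized distribution on $T^*$ is obtained by repeatedly deleting leaves not in $T^*$ with this rule. For a vertex $x$, $T_x$ is the subtree consisting of $x$ and all its neighbors, and $C_x$ is the induced generalized distribution on $T_x$. -}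

module Defs where

open import Level using (Level; 0ℓ) renaming (suc to lsuc)
open import Data.Nat using (ℕ; _≤_; _∸_; _/_) renaming (_+_ to _+ℕ_)
open import Data.Integer using (ℤ; +_; -[1+_]; _-_; _+_; _*_)
open import Data.Fin using (Fin; _≟_)
open import Data.List using (List; []; _∷_; _++_; length)
open import Data.List.Relation.Unary.Linked using (Linked)
open import Data.List.Relation.Unary.Unique.Propositional using (Unique)
open import Data.Product using (Σ; _×_; _,_)
open import Data.Sum using (_⊎_)
open import Data.Empty using (⊥)
open import Relation.Nullary using (¬_; yes; no)
open import Relation.Binary.PropositionalEquality using (_≡_)
open import Relation.Binary.Construct.Closure.ReflexiveTransitive using (Star)

module _ {n : ℕ} (Adj : Fin n → Fin n → Set) where

  data Walk : Fin n → Fin n → Set where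
    nil  : ∀ {v} → Walk v v
    cons : ∀ {u w v} → Adj u w → Walk w v → Walk u v

  IsCycle : List (Fin n) → Set
  IsCycle []       = ⊥
  IsCycle (v ∷ vs) = (2 ≤ length vs) × Unique (v ∷ vs) × Linked Adj ((v ∷ vs) ++ (v ∷ []))

  record IsTree : Set where
    field
      adj-sym    : ∀ {u v} → Adj u v → Adj v u
      adj-irrefl : ∀ {v} → ¬ Adj v v
      connected  : ∀ u v → Walk u v
      acyclic    : ∀ c → ¬ IsCycle c

module _ {n : ℕ} (Adj : Fin n → Fin n → Set) where

  move : (Fin n → ℕ) → Fin n → Fin n → (Fin n → ℕ)
  move D v u z with z ≟ v | z ≟ u
  ... | yes _ | _     = D z ∸ 2
  ... | no _  | yes _ = D z +ℕ 1
  ... | no _  | no _  = D z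

  data PebblingMove (D : Fin n → ℕ) : (Fin n → ℕ) → Set where
    pmove : ∀ {v u} → Adj v u → 2 ≤ D v → PebblingMove D (move D v u)

  Solvable : (ω : Fin n → ℕ) → (D : Fin n → ℕ) → Set
  Solvable ω D = Σ (Fin n → ℕ) λ D* → Star PebblingMove D D* × (∀ z → ω z ≤ D* z)

-- contribution of a deleted leaf with value c to its neighbour:
-- ⌊c/2⌋ if c ≥ 0, and 2c if c < 0
contrib : ℤ → ℤ
contrib (+ k)     = + (k / 2)
contrib -[1+ k ]  = (+ 2) * -[1+ k ]

update : ∀ {n} → (Fin n → ℤ) → Fin n → ℤ → (Fin n → ℤ)
update f u a z with z ≟ u
... | yes _ = a
... | no _  = f z

module _ {n : ℕ} (Adj : Fin n → Fin n → Set) (T* : Fin n → Set) where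

  State : Set₁
  State = (Fin n → Set) × (Fin n → ℤ)

  data LeafDeletion : State → State → Set₁ where
    delete : ∀ {S C} (v u : Fin n) →
             S v → ¬ T* v → S u → Adj v u →
             (∀ w → S w → Adj v w → w ≡ u) →
             LeafDeletion (S , C)
               ((λ z → S z × ¬ (z ≡ v)) , update C u (C u + contrib (C v)))

  -- C* is (a version of) the generalized distribution induced on T* by C:
  -- obtained from C on the whole tree by repeatedly deleting leaves not in
  -- T* until the vertex set is exactly T*.
  InducedOn : (C : Fin n → ℤ) → (C* : Fin n → ℤ) → Set₁
  InducedOn C C* =
    Σ (Fin n → Set) λ S →
      Star LeafDeletion ((λ _ → Fin n) , C) (S , C*) ×
      (∀ z → (S z → T* z) × (T* z → S z))

Star-at : ∀ {n} → (Fin n → Fin n → Set) → Fin n → (Fin n → Set)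
Star-at Adj x z = (z ≡ x) ⊎ Adj x z

excess : ∀ {n} → (Fin n → ℕ) → (Fin n → ℕ) → (Fin n → ℤ)
excess D ω z = (+ D z) - (+ ω z)

module Submission where

-- Cut the tree at the edge xy into the branch Bx on x's side
-- and the branch By on y's side.  Deleting leaves towards Tₓ collapses all
-- of By onto y, so Cₓ(y) is the result of folding the excess D − ω of By
-- into y.  The key invariant (`Certifies`) of a leaf deletion is read
-- backwards: if after deleting v (neighbour u) a distribution meeting the
-- corrected demand can be rearranged inside the branch, then so it could
-- before; a positive excess ⌊c/2⌋ is produced by first moving pebbles
-- v → u, and a deficit 2c is paid by afterwards moving c pebbles u → v.
-- Hence Cₓ(y) ≥ 0 lets D be rearranged inside By to meet ω on By, and
-- symmetrically Cᵧ(x) ≥ 0 does the same inside Bx.  The branches are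
-- disjoint and cover the tree, so both would make D ω-solvable.

open import Defs
open import Data.Nat using (ℕ)
open import Data.Integer using (ℤ; +_; _≤_; _<_)
open import Data.Fin using (Fin)
open import Relation.Nullary using (¬_)

open import Data.Nat as ℕ using (zero; suc; z≤n; s≤s; _∸_; _/_)
  renaming (_≤_ to _≤ℕ_; _+_ to _+ℕ_; _*_ to _*ℕ_)
import Data.Nat.Properties as ℕP
open import Data.Nat.DivMod using (m/n*n≤m)
import Data.Nat.Tactic.RingSolver as ℕSolver
open import Data.Integer as ℤ using (-[1+_]; -_; +≤+)
  renaming (_+_ to _+ℤ_; _*_ to _*ℤ_; _-_ to _-ℤ_)
import Data.Integer.Properties as ℤP
open import Data.Integer.Tactic.RingSolver using (solve-∀)
open import Data.Fin using (_≟_)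
open import Data.Vec.Functional using (updateAt)
open import Data.Vec.Functional.Properties using (updateAt-updates; updateAt-minimal)
open import Data.List using (List; []; _∷_; _++_; length)
open import Data.List.Relation.Unary.Linked using (Linked; [-]; _∷_)
open import Data.List.Relation.Unary.All using ([])
open import Data.List.Relation.Unary.AllPairs using ([]; _∷_)
open import Data.List.Relation.Unary.All.Properties using (¬Any⇒All¬)
open import Data.List.Relation.Unary.Unique.Propositional using (Unique)
open import Data.List.Relation.Unary.Any using (Any; here; there; any?)
open import Data.Product using (Σ; _×_; _,_; proj₁; proj₂)
open import Data.Sum using (_⊎_; inj₁; inj₂)
open import Data.Empty using (⊥; ⊥-elim)
open import Relation.Nullary using (yes; no; Dec)
open import Relation.Binary.PropositionalEquality
  using (_≡_; _≢_; refl; sym; trans; cong; subst)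
open import Relation.Binary.Construct.Closure.ReflexiveTransitive using (Star; ε; _◅_; _◅◅_)

-- Moving c + 1 pebbles off a vertex needs two pebbles now and 2c later.
two-then-rest : ∀ {a c q} → a +ℕ 2 *ℕ suc c ≤ℕ q → 2 ≤ℕ q × a +ℕ 2 *ℕ c ≤ℕ q ∸ 2
two-then-rest {a} {c} {q} h =
  ℕP.≤-trans (ℕP.m≤n+m 2 _) h′ , ℕP.m+n≤o⇒m≤o∸n (a +ℕ 2 *ℕ c) h′
  where
  regroup : ∀ a c → a +ℕ 2 *ℕ suc c ≡ (a +ℕ 2 *ℕ c) +ℕ 2
  regroup = ℕSolver.solve-∀
  h′ : (a +ℕ 2 *ℕ c) +ℕ 2 ≤ℕ q
  h′ = subst (_≤ℕ q) (regroup a c) h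

-- A surplus m at v lets v give away ⌊m/2⌋ pebbles at cost 2⌊m/2⌋ ≤ m.
halving-affordable : ∀ w m {p} → + w +ℤ + m ≤ + p → w +ℕ 2 *ℕ (m / 2) ≤ℕ p
halving-affordable w m h =
  ℕP.≤-trans (ℕP.+-monoʳ-≤ w (subst (_≤ℕ m) (ℕP.*-comm (m / 2) 2) (m/n*n≤m m 2)))
             (ℤP.drop‿+≤+ h)

-- A deficit of c at v means that all but c of its demand is already present.
deficit-bound : ∀ w k {p} → + w +ℤ -[1+ k ] ≤ + p → w ∸ suc k ≤ℕ p
deficit-bound w k {p} h with suc k ℕ.≤? w
... | yes c≤w = ℤP.drop‿+≤+ (subst (_≤ + p) (ℤP.⊖-≥ c≤w) h)
... | no  c≰w = subst (_≤ℕ p) (sym (ℕP.m≤n⇒m∸n≡0 (ℕP.≰⇒≥ c≰w))) z≤n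

-- Raising a demand by 2c exactly compensates a contribution −2c.
double-cancels : ∀ a k (x : ℤ) → + (a +ℕ 2 *ℕ suc k) +ℤ (x +ℤ (+ 2) *ℤ -[1+ k ]) ≡ + a +ℤ x
double-cancels a k x =
  trans (cong (_+ℤ (x +ℤ (+ 2) *ℤ -[1+ k ]))
              (trans (ℤP.pos-+ a (2 *ℕ suc k)) (cong (+ a +ℤ_) (ℤP.pos-* 2 (suc k)))))
        (cancel (+ a) x (+ suc k))
  where
  cancel : ∀ a x s → (a +ℤ (+ 2) *ℤ s) +ℤ (x +ℤ (+ 2) *ℤ (- s)) ≡ a +ℤ x
  cancel = solve-∀

excess-covers : ∀ (w d : ℕ) → + w +ℤ (+ d -ℤ + w) ≤ + d
excess-covers w d = ℤP.≤-reflexive (telescope (+ w) (+ d))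
  where
  telescope : ∀ a d → a +ℤ (d -ℤ a) ≡ d
  telescope = solve-∀

update-elsewhere : ∀ {n} (f : Fin n → ℤ) u a z → z ≢ u → update f u a z ≡ f z
update-elsewhere f u a z z≢u with z ≟ u
... | yes z≡u = ⊥-elim (z≢u z≡u)
... | no  _   = refl

module Certificates {n : ℕ} (Adj : Fin n → Fin n → Set)
  (adj-sym : ∀ {u v} → Adj u v → Adj v u) (adj-irrefl : ∀ {v} → ¬ Adj v v) where

  adjacent-distinct : ∀ {u v} → Adj u v → u ≢ v
  adjacent-distinct uv refl = adj-irrefl uv

  _⇝_ : (Fin n → ℕ) → (Fin n → ℕ) → Set
  _⇝_ = Star (PebblingMove Adj)

  move-source : ∀ D v u → move Adj D v u v ≡ D v ∸ 2
  move-source D v u with v ≟ v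
  ... | yes _   = refl
  ... | no  v≢v = ⊥-elim (v≢v refl)

  move-target : ∀ D v u → u ≢ v → move Adj D v u u ≡ D u +ℕ 1
  move-target D v u u≢v with u ≟ v | u ≟ u
  ... | yes u≡v | _      = ⊥-elim (u≢v u≡v)
  ... | no _    | yes _  = refl
  ... | no _    | no u≢u = ⊥-elim (u≢u refl)

  move-other : ∀ D v u z → z ≢ v → z ≢ u → move Adj D v u z ≡ D z
  move-other D v u z z≢v z≢u with z ≟ v | z ≟ u
  ... | yes z≡v | _       = ⊥-elim (z≢v z≡v)
  ... | no _    | yes z≡u = ⊥-elim (z≢u z≡u)
  ... | no _    | no _    = refl

  transfer : ∀ {u v} → Adj u v → ∀ c (Q : Fin n → ℕ) {a} → a +ℕ 2 *ℕ c ≤ℕ Q u →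
             Σ (Fin n → ℕ) λ Q′ → Q ⇝ Q′ × a ≤ℕ Q′ u × Q v +ℕ c ≤ℕ Q′ v ×
               (∀ z → z ≢ u → z ≢ v → Q′ z ≡ Q z)
  transfer {u} {v} uv zero Q {a} h =
    Q , ε , subst (_≤ℕ Q u) (ℕP.+-identityʳ a) h ,
    ℕP.≤-reflexive (ℕP.+-identityʳ (Q v)) , λ _ _ _ → refl
  transfer {u} {v} uv (suc c) Q {a} h with two-then-rest {a} {c} h
  ... | two , rest
    with transfer uv c (move Adj Q u v) (subst (a +ℕ 2 *ℕ c ≤ℕ_) (sym (move-source Q u v)) rest)
  ... | Q′ , Q₁⇝Q′ , a≤ , gain , same =
    Q′ , pmove uv two ◅ Q₁⇝Q′ , a≤ ,
    subst (_≤ℕ Q′ v) (trans (cong (_+ℕ c) (move-target Q u v v≢u)) (ℕP.+-assoc (Q v) 1 c)) gain ,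
    λ z z≢u z≢v → trans (same z z≢u z≢v) (move-other Q u v z z≢u z≢v)
    where
    v≢u : v ≢ u
    v≢u v≡u = adjacent-distinct uv (sym v≡u)

  ReachableOn : (R : Fin n → Set) → (P W : Fin n → ℕ) → Set
  ReachableOn R P W =
    Σ (Fin n → ℕ) λ P* → P ⇝ P* × (∀ z → R z → W z ≤ℕ P* z) × (∀ z → ¬ R z → P* z ≡ P z)

  -- On R, P meets W corrected by C on the remaining vertices S, and meets W
  -- itself on the vertices deleted so far.
  Covers : (R S : Fin n → Set) → (Fin n → ℤ) → (P W : Fin n → ℕ) → Set
  Covers R S C P W =
    (∀ z → R z → S z → + W z +ℤ C z ≤ + P z) × (∀ z → R z → ¬ S z → W z ≤ℕ P z)

  Certifies : (R : Fin n → Set) → (Fin n → Set) × (Fin n → ℤ) → Set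
  Certifies R (S , C) = ∀ P W → Covers R S C P W → ReachableOn R P W

  reach-after : ∀ {R P P₁ W} → P ⇝ P₁ → (∀ z → ¬ R z → P₁ z ≡ P z) →
                ReachableOn R P₁ W → ReachableOn R P W
  reach-after P⇝P₁ same₁ (P₂ , P₁⇝P₂ , meets , same₂) =
    P₂ , P⇝P₁ ◅◅ P₁⇝P₂ , meets , λ z z∉R → trans (same₂ z z∉R) (same₁ z z∉R)

  -- Meeting a demand W′ that asks 2c more at u and up to c less at v
  -- suffices to meet W: finish by transferring c pebbles from u to v.
  settle : ∀ {R u v} c {P W W′} → Adj u v → R u → R v →
           W u +ℕ 2 *ℕ c ≤ℕ W′ u → W v ≤ℕ W′ v +ℕ c →
           (∀ z → z ≢ u → z ≢ v → W z ≤ℕ W′ z) →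
           ReachableOn R P W′ → ReachableOn R P W
  settle {R} {u} {v} c {P} {W} {W′} uv Ru Rv at-u at-v elsewhere (P₁ , P⇝P₁ , meets₁ , same₁)
    with transfer uv c P₁ (ℕP.≤-trans at-u (meets₁ u Ru))
  ... | P₂ , P₁⇝P₂ , Wu≤ , gain , same = P₂ , P⇝P₁ ◅◅ P₁⇝P₂ , meets , outside
    where
    meets : ∀ z → R z → W z ≤ℕ P₂ z
    meets z Rz with z ≟ u | z ≟ v
    ... | yes refl | _        = Wu≤
    ... | no _     | yes refl = ℕP.≤-trans at-v (ℕP.≤-trans (ℕP.+-monoˡ-≤ c (meets₁ v Rv)) gain)
    ... | no z≢u   | no z≢v   =
      subst (W z ≤ℕ_) (sym (same z z≢u z≢v)) (ℕP.≤-trans (elsewhere z z≢u z≢v) (meets₁ z Rz))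
    outside : ∀ z → ¬ R z → P₂ z ≡ P z
    outside z z∉R = trans (same z (λ { refl → z∉R Ru }) (λ { refl → z∉R Rv })) (same₁ z z∉R)

  -- Deleting a leaf v with neighbour u, both in R, preserves certification
  -- backwards.  Nonnegative case C(v) = m: first move ⌊m/2⌋ pebbles v → u.
  absorb-surplus : ∀ {R S C v u m} → Adj v u → R v → R u → S v → S u → C v ≡ + m →
                   Certifies R ((λ z → S z × z ≢ v) , update C u (C u +ℤ + (m / 2))) →
                   Certifies R (S , C)
  absorb-surplus {R} {S} {C} {v} {u} {m} vu Rv Ru Sv Su Cv≡m certified P W (onS , offS)
    with transfer vu (m / 2) P
           (halving-affordable (W v) m (subst (λ t → + W v +ℤ t ≤ + P v) Cv≡m (onS v Rv Sv)))
  ... | P₁ , P⇝P₁ , Wv≤ , gain , same = reach-after P⇝P₁ outside (certified P₁ W (onS′ , offS′))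
    where
    open ℤP.≤-Reasoning
    -- The split on z ≟ u also evaluates `update` in the goal.
    onS′ : ∀ z → R z → S z × z ≢ v → + W z +ℤ update C u (C u +ℤ + (m / 2)) z ≤ + P₁ z
    onS′ z Rz (Sz , z≢v) with z ≟ u
    ... | yes refl = begin
      + W u +ℤ (C u +ℤ + (m / 2))             ≡⟨ sym (ℤP.+-assoc (+ W u) (C u) _) ⟩
      (+ W u +ℤ C u) +ℤ + (m / 2)             ≤⟨ ℤP.+-monoˡ-≤ (+ (m / 2)) (onS u Ru Su) ⟩
      + (P u +ℕ m / 2)                        ≤⟨ +≤+ gain ⟩
      + P₁ u                                  ∎
    ... | no z≢u = begin
      + W z +ℤ C z                            ≤⟨ onS z Rz Sz ⟩
      + P z                                   ≡⟨ cong +_ (sym (same z z≢v z≢u)) ⟩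
      + P₁ z                                  ∎
    offS′ : ∀ z → R z → ¬ (S z × z ≢ v) → W z ≤ℕ P₁ z
    offS′ z Rz z∉S′ with z ≟ v
    ... | yes refl = Wv≤
    ... | no z≢v = subst (W z ≤ℕ_) (sym (same z z≢v z≢u)) (offS z Rz (λ Sz → z∉S′ (Sz , z≢v)))
      where
      z≢u : z ≢ u
      z≢u refl = z∉S′ (Su , z≢v)
    outside : ∀ z → ¬ R z → P₁ z ≡ P z
    outside z z∉R = same z (λ { refl → z∉R Rv }) (λ { refl → z∉R Ru })

  -- Negative case C(v) = −c: demand 2c more at u (and c less at v), then
  -- settle by moving c pebbles u → v.
  absorb-deficit : ∀ {R S C v u k} → Adj v u → R v → R u → S v → S u → C v ≡ -[1+ k ] →
                   Certifies R ((λ z → S z × z ≢ v) , update C u (C u +ℤ (+ 2) *ℤ -[1+ k ])) →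
                   Certifies R (S , C)
  absorb-deficit {R} {S} {C} {v} {u} {k} vu Rv Ru Sv Su Cv≡ certified P W (onS , offS) =
    settle c (adj-sym vu) Ru Rv (ℕP.≤-reflexive (sym W′u)) at-v
      (λ z z≢u z≢v → ℕP.≤-reflexive (sym (W′-elsewhere z z≢u z≢v)))
      (certified P W′ (onS′ , offS′))
    where
    c = suc k
    W′ : Fin n → ℕ
    W′ = updateAt (updateAt W v (_∸ c)) u (_+ℕ 2 *ℕ c)
    u≢v : u ≢ v
    u≢v u≡v = adjacent-distinct vu (sym u≡v)
    W′u : W′ u ≡ W u +ℕ 2 *ℕ c
    W′u = trans (updateAt-updates u _) (cong (_+ℕ 2 *ℕ c) (updateAt-minimal u v W u≢v))
    W′v : W′ v ≡ W v ∸ c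
    W′v = trans (updateAt-minimal v u _ (λ v≡u → u≢v (sym v≡u))) (updateAt-updates v W)
    W′-elsewhere : ∀ z → z ≢ u → z ≢ v → W′ z ≡ W z
    W′-elsewhere z z≢u z≢v = trans (updateAt-minimal z u _ z≢u) (updateAt-minimal z v W z≢v)
    at-v : W v ≤ℕ W′ v +ℕ c
    at-v = subst (λ t → W v ≤ℕ t +ℕ c) (sym W′v)
             (subst (W v ≤ℕ_) (ℕP.+-comm c (W v ∸ c)) (ℕP.m≤n+m∸n (W v) c))
    open ℤP.≤-Reasoning
    onS′ : ∀ z → R z → S z × z ≢ v →
           + W′ z +ℤ update C u (C u +ℤ (+ 2) *ℤ -[1+ k ]) z ≤ + P z
    onS′ z Rz (Sz , z≢v) with z ≟ u
    ... | yes refl = begin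
      + W′ u +ℤ (C u +ℤ (+ 2) *ℤ -[1+ k ])
        ≡⟨ cong (λ w → + w +ℤ (C u +ℤ (+ 2) *ℤ -[1+ k ])) W′u ⟩
      + (W u +ℕ 2 *ℕ c) +ℤ (C u +ℤ (+ 2) *ℤ -[1+ k ]) ≡⟨ double-cancels (W u) k (C u) ⟩
      + W u +ℤ C u                                    ≤⟨ onS u Ru Su ⟩
      + P u                                           ∎
    ... | no z≢u = begin
      + W′ z +ℤ C z ≡⟨ cong (λ w → + w +ℤ C z) (W′-elsewhere z z≢u z≢v) ⟩
      + W z +ℤ C z ≤⟨ onS z Rz Sz ⟩
      + P z        ∎
    offS′ : ∀ z → R z → ¬ (S z × z ≢ v) → W′ z ≤ℕ P z
    offS′ z Rz z∉S′ with z ≟ v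
    ... | yes refl =
      subst (_≤ℕ P v) (sym W′v) (deficit-bound (W v) k (subst (λ t → + W v +ℤ t ≤ + P v) Cv≡ (onS v Rv Sv)))
    ... | no z≢v =
      subst (_≤ℕ P z) (sym (W′-elsewhere z z≢u z≢v)) (offS z Rz (λ Sz → z∉S′ (Sz , z≢v)))
      where
      z≢u : z ≢ u
      z≢u refl = z∉S′ (Su , z≢v)

  delete-outside : ∀ {R S C v u} (a : ℤ) → ¬ R v → ¬ R u →
                   Certifies R ((λ z → S z × z ≢ v) , update C u a) → Certifies R (S , C)
  delete-outside {R} {S} {C} {v} {u} a v∉R u∉R certified P W (onS , offS) =
    certified P W (onS′ , offS′)
    where
    onS′ : ∀ z → R z → S z × z ≢ v → + W z +ℤ update C u a z ≤ + P z
    onS′ z Rz (Sz , _) =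
      subst (λ t → + W z +ℤ t ≤ + P z) (sym (update-elsewhere C u a z λ { refl → u∉R Rz }))
            (onS z Rz Sz)
    offS′ : ∀ z → R z → ¬ (S z × z ≢ v) → W z ≤ℕ P z
    offS′ z Rz z∉S′ = offS z Rz (λ Sz → z∉S′ (Sz , λ { refl → v∉R Rz }))

  Sealed : (R T* : Fin n → Set) → Set
  Sealed R T* = ∀ {v u} → ¬ T* v → Adj v u → (R v → R u) × (R u → R v)

  deletion-preserves : ∀ {R T*} → (∀ z → Dec (R z)) → Sealed R T* →
                       ∀ {s t} → LeafDeletion Adj T* s t → Certifies R t → Certifies R s
  deletion-preserves R? sealed (delete {C = C} v u Sv v∉T* Su vu _) with R? v | C v in Cv≡
  ... | yes Rv | + m      = absorb-surplus vu Rv (proj₁ (sealed v∉T* vu) Rv) Sv Su Cv≡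
  ... | yes Rv | -[1+ k ] = absorb-deficit vu Rv (proj₁ (sealed v∉T* vu) Rv) Sv Su Cv≡
  ... | no v∉R | _        = delete-outside _ v∉R (λ Ru → v∉R (proj₂ (sealed v∉T* vu) Ru))

  derivation-preserves : ∀ {R T*} → (∀ z → Dec (R z)) → Sealed R T* →
                         ∀ {s t} → Star (LeafDeletion Adj T*) s t → Certifies R t → Certifies R s
  derivation-preserves R? sealed ε        certified = certified
  derivation-preserves R? sealed (d ◅ ds) certified =
    deletion-preserves R? sealed d (derivation-preserves R? sealed ds certified)

  single-vertex-certifies : ∀ {R S C b} → R b → S b → (∀ z → R z → S z → z ≡ b) → + 0 ≤ C b →
                            Certifies R (S , C)
  single-vertex-certifies {R} {S} {C} {b} Rb Sb only-b Cb≥0 P W (onS , offS) =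
    P , ε , meets , λ _ _ → refl
    where
    meets : ∀ z → R z → W z ≤ℕ P z
    meets z Rz with z ≟ b
    ... | yes refl = ℤP.drop‿+≤+ (ℤP.≤-trans (ℤP.i≤i+j (+ W b) (C b) {{ℤ.nonNegative Cb≥0}}) (onS b Rb Sb))
    ... | no z≢b   = offS z Rz (λ Sz → z≢b (only-b z Rz Sz))

module Branches {n : ℕ} (Adj : Fin n → Fin n → Set) (tree : IsTree Adj) where
  open IsTree tree

  data WalkAvoiding (p : Fin n) : Fin n → Fin n → Set where
    stay : ∀ {a} → a ≢ p → WalkAvoiding p a a
    step : ∀ {a c b} → a ≢ p → Adj a c → WalkAvoiding p c b → WalkAvoiding p a b

  Branch : Fin n → Fin n → Fin n → Set
  Branch a b z = WalkAvoiding a z b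

  start-avoids : ∀ {p a b} → WalkAvoiding p a b → a ≢ p
  start-avoids (stay a≢p)     = a≢p
  start-avoids (step a≢p _ _) = a≢p

  extend : ∀ {p a b c} → WalkAvoiding p a b → Adj b c → c ≢ p → WalkAvoiding p a c
  extend (stay a≢p)      bc c≢p = step a≢p bc (stay c≢p)
  extend (step a≢p ac w) bc c≢p = step a≢p ac (extend w bc c≢p)

  reverse : ∀ {p a b} → WalkAvoiding p a b → WalkAvoiding p b a
  reverse (stay a≢p)      = stay a≢p
  reverse (step a≢p ac w) = extend (reverse w) (adj-sym ac) a≢p

  OtherEdge : Fin n → Fin n → Fin n → Fin n → Set
  OtherEdge a b c d = Adj c d × ¬ (c ≡ a × d ≡ b) × ¬ (c ≡ b × d ≡ a)

  avoids-edge : ∀ {p a b c d} → p ≡ a ⊎ p ≡ b → c ≢ p → d ≢ p → Adj c d → OtherEdge a b c d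
  avoids-edge (inj₁ refl) c≢p d≢p cd = cd , (λ { (c≡a , _) → c≢p c≡a }) , (λ { (_ , d≡a) → d≢p d≡a })
  avoids-edge (inj₂ refl) c≢p d≢p cd = cd , (λ { (_ , d≡b) → d≢p d≡b }) , (λ { (c≡b , _) → c≢p c≡b })

  avoiding-walk : ∀ {p a b c d} → p ≡ a ⊎ p ≡ b → WalkAvoiding p c d → Walk (OtherEdge a b) c d
  avoiding-walk p∈ab (stay _)         = nil
  avoiding-walk p∈ab (step c≢p ce w) =
    cons (avoids-edge p∈ab c≢p (start-avoids w) ce) (avoiding-walk p∈ab w)

  vertices : ∀ {E : Fin n → Fin n → Set} {a b} → Walk E a b → List (Fin n)
  vertices {a = a} nil        = a ∷ []
  vertices {a = a} (cons _ w) = a ∷ vertices w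

  vertices-nonempty : ∀ {E : Fin n → Fin n → Set} {a b} (w : Walk E a b) → 1 ≤ℕ length (vertices w)
  vertices-nonempty nil        = s≤s z≤n
  vertices-nonempty (cons _ _) = s≤s z≤n

  append : ∀ {E : Fin n → Fin n → Set} {a b c} → Walk E a b → Walk E b c → Walk E a c
  append nil        w′ = w′
  append (cons e w) w′ = cons e (append w w′)

  -- Every walk contains a path (a walk without repeated vertices) with the
  -- same ends: drop the loop between the first visit of a vertex and the rest.
  path-from : ∀ {E : Fin n → Fin n → Set} {a c b} (w : Walk E c b) →
              Any (a ≡_) (vertices w) → Unique (vertices w) →
              Σ (Walk E a b) λ w′ → Unique (vertices w′)
  path-from nil        (here refl) distinct       = nil , distinct
  path-from (cons e w) (here refl) distinct       = cons e w , distinct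
  path-from (cons e w) (there a∈w) (_ ∷ distinct) = path-from w a∈w distinct

  to-path : ∀ {E : Fin n → Fin n → Set} {a b} → Walk E a b → Σ (Walk E a b) λ w → Unique (vertices w)
  to-path nil = nil , ([] ∷ [])
  to-path {a = a} (cons e w) with to-path w
  ... | p , distinct with any? (a ≟_) (vertices p)
  ...   | yes a∈p = path-from p a∈p distinct
  ...   | no  a∉p = cons e p , (¬Any⇒All¬ (vertices p) a∉p ∷ distinct)

  closing-linked : ∀ {a b c d t} (w : Walk (OtherEdge a b) c d) → Adj d t →
                   Linked Adj (vertices w ++ t ∷ [])
  closing-linked nil                dt = dt ∷ [-]
  closing-linked (cons e nil)       dt = proj₁ e ∷ dt ∷ [-]
  closing-linked (cons e (cons f w)) dt = proj₁ e ∷ closing-linked (cons f w) dt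

  -- Every edge of a tree is a bridge: a path a … b avoiding ab, closed by
  -- the edge ba, would be a cycle.
  edge-is-bridge : ∀ {a b} → Adj a b → ¬ Walk (OtherEdge a b) a b
  edge-is-bridge {a} {b} ab w with to-path w
  ... | nil , _                       = adj-irrefl ab
  ... | cons e nil , _                = proj₁ (proj₂ e) (refl , refl)
  ... | cons e (cons f p) , distinct =
    acyclic (vertices (cons e (cons f p)))
            (s≤s (vertices-nonempty p) , distinct , closing-linked (cons e (cons f p)) (adj-sym ab))

  -- The two branches at an edge xy are disjoint ...
  branches-disjoint : ∀ {x y z} → Adj x y → Branch y x z → Branch x y z → ⊥
  branches-disjoint xy z→x z→y =
    edge-is-bridge xy (append (avoiding-walk (inj₂ refl) (reverse z→x)) (avoiding-walk (inj₁ refl) z→y))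

  -- ... and cover the tree: follow a walk from z to x until it meets x or y.
  branches-cover : ∀ {x y} → Adj x y → ∀ z → Branch y x z ⊎ Branch x y z
  branches-cover {x} {y} xy z = classify (connected z x)
    where
    x≢y : x ≢ y
    x≢y refl = adj-irrefl xy
    classify : ∀ {z} → Walk Adj z x → Branch y x z ⊎ Branch x y z
    classify nil = inj₁ (stay x≢y)
    classify {z} (cons zc w) with z ≟ x | z ≟ y | classify w
    ... | yes refl | _        | _        = inj₁ (stay x≢y)
    ... | no _     | yes refl | _        = inj₂ (stay (λ y≡x → x≢y (sym y≡x)))
    ... | no z≢x   | no z≢y   | inj₁ c∈X = inj₁ (step z≢y zc c∈X)
    ... | no z≢x   | no z≢y   | inj₂ c∈Y = inj₂ (step z≢x zc c∈Y)

  branch? : ∀ {a b} → Adj a b → ∀ z → Dec (Branch a b z)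
  branch? ab z with branches-cover ab z
  ... | inj₁ z∈other = no (branches-disjoint ab z∈other)
  ... | inj₂ z∈Bab   = yes z∈Bab

  other-neighbour-outside : ∀ {a b c} → Adj a b → Adj a c → c ≢ b → ¬ Branch a b c
  other-neighbour-outside ab ac c≢b c∈Bab =
    branches-disjoint (adj-sym ab) c∈Bab (step c≢b (adj-sym ac) (stay λ { refl → adj-irrefl ab }))

module BranchFolding {n : ℕ} (Adj : Fin n → Fin n → Set) (tree : IsTree Adj) where
  open IsTree tree
  open Certificates Adj adj-sym adj-irrefl
  open Branches Adj tree

  branch-sealed : ∀ {a b} → Sealed (Branch a b) (Star-at Adj a)
  branch-sealed {a} v∉Tₐ vu = (λ v∈B → step u≢a (adj-sym vu) v∈B) , (λ u∈B → step v≢a vu u∈B)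
    where
    u≢a : _ ≢ a
    u≢a refl = v∉Tₐ (inj₂ (adj-sym vu))
    v≢a : _ ≢ a
    v≢a refl = v∉Tₐ (inj₁ refl)

  branch-reachable : ∀ {a b C₀ Cₐ} → Adj a b → InducedOn Adj (Star-at Adj a) C₀ Cₐ → + 0 ≤ Cₐ b →
                     ∀ P W → (∀ z → Branch a b z → + W z +ℤ C₀ z ≤ + P z) → ReachableOn (Branch a b) P W
  branch-reachable {a} {b} {C₀} {Cₐ} ab (S , deletions , S≈Tₐ) Cₐb≥0 P W covers =
    derivation-preserves (branch? ab) branch-sealed deletions
      (single-vertex-certifies {C = Cₐ} (stay b≢a) (proj₂ (S≈Tₐ b) (inj₂ ab)) only-b Cₐb≥0)
      P W ((λ z z∈B _ → covers z z∈B) , (λ z _ z∉all → ⊥-elim (z∉all z)))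
    where
    b≢a : b ≢ a
    b≢a refl = adj-irrefl ab
    only-b : ∀ z → Branch a b z → S z → z ≡ b
    only-b z z∈B Sz with proj₁ (S≈Tₐ z) Sz | z ≟ b
    ... | _        | yes z≡b = z≡b
    ... | inj₁ z≡a | no _    = ⊥-elim (start-avoids z∈B z≡a)
    ... | inj₂ az  | no z≢b  = ⊥-elim (other-neighbour-outside ab az z≢b z∈B)

  -- If both folded values at the ends of xy are nonnegative, the two
  -- branches can be served one after the other, so D is ω-solvable.
  both-branches-solvable : ∀ {ω D x y Cx Cy} → Adj x y →
    InducedOn Adj (Star-at Adj x) (excess D ω) Cx → InducedOn Adj (Star-at Adj y) (excess D ω) Cy →
    + 0 ≤ Cx y → + 0 ≤ Cy x → Solvable Adj ω D
  both-branches-solvable {ω} {D} {x} {y} xy induced-x induced-y Cxy≥0 Cyx≥0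
    with branch-reachable (adj-sym xy) induced-y Cyx≥0 D ω (λ z _ → excess-covers (ω z) (D z))
  ... | P₁ , D⇝P₁ , meets₁ , same₁
    with branch-reachable xy induced-x Cxy≥0 P₁ ω
           (λ z z∈By → subst (λ t → + ω z +ℤ excess D ω z ≤ + t)
                             (sym (same₁ z (λ z∈Bx → branches-disjoint xy z∈Bx z∈By)))
                             (excess-covers (ω z) (D z)))
  ... | P₂ , P₁⇝P₂ , meets₂ , same₂ = P₂ , D⇝P₁ ◅◅ P₁⇝P₂ , meets
    where
    meets : ∀ z → ω z ≤ℕ P₂ z
    meets z with branches-cover xy z
    ... | inj₁ z∈Bx = subst (ω z ≤ℕ_) (sym (same₂ z (branches-disjoint xy z∈Bx))) (meets₁ z z∈Bx)
    ... | inj₂ z∈By = meets₂ z z∈By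

lemma5 : ∀ (n : ℕ) (Adj : Fin n → Fin n → Set) → IsTree Adj →
    ∀ (ω D : Fin n → ℕ) → ¬ Solvable Adj ω D →
    ∀ (x y : Fin n) → Adj x y →
    ∀ (Cx Cy : Fin n → ℤ) →
    InducedOn Adj (Star-at Adj x) (excess D ω) Cx →
    InducedOn Adj (Star-at Adj y) (excess D ω) Cy →
    + 0 ≤ Cx y → Cy x < + 0
lemma5 n Adj tree ω D unsolvable x y xy Cx Cy induced-x induced-y Cxy≥0 with + 0 ℤ.≤? Cy x
... | no  Cyx≱0 = ℤP.≰⇒> Cyx≱0
... | yes Cyx≥0 = ⊥-elim (unsolvable
        (BranchFolding.both-branches-solvable Adj tree xy induced-x induced-y Cxy≥0 Cyx≥0))
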